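{- In the coproduct construction of the context, assume all frames $L^i_\pm$ are nontrivial (i.e. $0\ne 1$ in each). For $i\in\mathcal I$ let $S^i_\pm=\{a\oplus_i\mathbf 1: a\in L^i_\pm\}\subseteq\bigoplus_jL^j_\pm$ be the set of $i$-strips. Then $(S^i_+,S^i_-;\mathsf{con}_1\cap(S^i_+\times S^i_-),\mathsf{tot}_1\cap(S^i_+\times S^i_-))\cong(L^i_+,L^i_-;\mathsf{con}^i,\mathsf{tot}^i)$.
   Context: Let $\{(L^i_+,L^i_-;\mathsf{con}^i,\mathsf{tot}^i)\}_{i\in\mathcal I}$ be a family of d-frames. For $\pm\in\{+,-\}$ let $B_\pm$ be the set of elements of $\prod_iL^i_\pm$ with all but finitely many coordinates $1$, $\mathbf 1$ its top; for $a\in L^j_\pm$, $u\in B_\pm$, $a*_ju$ has $j$-th coordinate $a$ and others $u_i$. $\mathcal C_\pm$ consists of all $\{a^k*_ju:k\in K\}\dashv(\bigvee_ka^k)*_ju$. $\bigoplus_jL^j_\pm$ is the frame (under inclusion) of $\mathcal C_\pm$-ideals, i.e. downsets $I\subseteq B_\pm$ with $U\dashv a\in\mathcal C_\pm,U\subseteq I\Rightarrow a\in I$. $\mathbf n_\pm=\{u:u_i=0\text{ for some }i\}$ and $a\oplus_ju=\downarrow(a*_ju)\cup\mathbf n_\pm$. $\mathsf{con}_1=\{(a\oplus_j\mathbf 1,b\oplus_j\mathbf 1):j\in\mathcal I,(a,b)\in\mathsf{con}^j\}$ and $\mathsf{tot}_1=\{(a\oplus_j\mathbf 1,b\oplus_j\mathbf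 1):j\in\mathcal I,(a,b)\in\mathsf{tot}^j\}$. The sets $S^i_\pm$ carry the inclusion order inherited from $\bigoplus_jL^j_\pm$; the isomorphism is one of structures consisting of two frames with two binary relations (a pair of frame isomorphisms preserving and reflecting both relations). -}

module Defs where

open import Level using (Level; _⊔_) renaming (suc to lsuc; zero to lzero)
open import Data.Product using (Σ; _×_; _,_; proj₁; proj₂)
open import Data.Sum using (_⊎_; inj₁; inj₂)
open import Data.Bool using (Bool; true; false)
open import Data.Empty using (⊥-elim) renaming (⊥ to Empty)
open import Data.List using (List; []; _∷_)
open import Data.List.Membership.Propositional using (_∈_; _∉_)
open import Data.List.Relation.Unary.Any using (here; there)
open import Relation.Binary.PropositionalEquality using (_≡_; refl)
open import Relation.Binary.Definitions using (DecidableEquality)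
open import Relation.Nullary using (¬_; yes; no)

record Frame : Set₁ where
  infix 4 _≤_
  infixr 7 _∧_
  field
    Carrier   : Set
    _≤_       : Carrier → Carrier → Set
    ≤-refl    : ∀ {x} → x ≤ x
    ≤-trans   : ∀ {x y z} → x ≤ y → y ≤ z → x ≤ z
    ≤-antisym : ∀ {x y} → x ≤ y → y ≤ x → x ≡ y
    ⋁         : {K : Set} → (K → Carrier) → Carrier
    ⋁-ub      : ∀ {K : Set} (f : K → Carrier) (k : K) → f k ≤ ⋁ f
    ⋁-least   : ∀ {K : Set} (f : K → Carrier) {x : Carrier} → (∀ k → f k ≤ x) → ⋁ f ≤ x
    𝟏         : Carrier
    𝟏-max     : ∀ {x} → x ≤ 𝟏
    _∧_       : Carrier → Carrier → Carrier
    ∧-lb₁     : ∀ {x y} → x ∧ y ≤ x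
    ∧-lb₂     : ∀ {x y} → x ∧ y ≤ y
    ∧-glb     : ∀ {x y z} → z ≤ x → z ≤ y → z ≤ x ∧ y
    ∧-⋁-distrib : ∀ (x : Carrier) {K : Set} (f : K → Carrier) → x ∧ ⋁ f ≤ ⋁ (λ k → x ∧ f k)

  𝟎 : Carrier
  𝟎 = ⋁ {Empty} ⊥-elim

  infixr 6 _∨_
  _∨_ : Carrier → Carrier → Carrier
  x ∨ y = ⋁ {Bool} (λ { true → x ; false → y })

open Frame public using (Carrier; 𝟎; 𝟏)

Nontrivial : Frame → Set
Nontrivial L = ¬ (Frame.𝟎 L ≡ Frame.𝟏 L)

record DFrame : Set₁ where
  field
    L⁺ L⁻ : Frame
  private
    module P = Frame L⁺
    module M = Frame L⁻
  field
    con tot : Carrier L⁺ → Carrier L⁻ → Set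
    con-↓ : ∀ {a b a' b'} → con a b → a' P.≤ a → b' M.≤ b → con a' b'
    tot-↑ : ∀ {a b a' b'} → tot a b → a P.≤ a' → b M.≤ b' → tot a' b'
    con-tt : con P.𝟏 M.𝟎
    con-ff : con P.𝟎 M.𝟏
    tot-tt : tot P.𝟏 M.𝟎
    tot-ff : tot P.𝟎 M.𝟏
    con-∧ : ∀ {a b a' b'} → con a b → con a' b' → con (a P.∧ a') (b M.∨ b')
    con-∨ : ∀ {a b a' b'} → con a b → con a' b' → con (a P.∨ a') (b M.∧ b')
    tot-∧ : ∀ {a b a' b'} → tot a b → tot a' b' → tot (a P.∧ a') (b M.∨ b')
    tot-∨ : ∀ {a b a' b'} → tot a b → tot a' b' → tot (a P.∨ a') (b M.∧ b')
    -- con is closed under directed joins in the information order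
    con-dir : ∀ {K : Set} (f : K → Carrier L⁺) (g : K → Carrier L⁻) →
              K →
              (∀ k k' → Σ K λ k'' → (f k P.≤ f k'' × g k M.≤ g k'')
                                  × (f k' P.≤ f k'' × g k' M.≤ g k'')) →
              (∀ k → con (f k) (g k)) → con (P.⋁ f) (M.⋁ g)
    con-tot : ∀ {a b c d} → con a b → tot c d → (a ≡ c ⊎ b ≡ d) →
              (a P.≤ c × b M.≤ d)

-- Coproduct of a family of frames, presented by C-ideals.

module Coproduct (I : Set) (_≟_ : DecidableEquality I) (F : I → Frame) where

  upd : ((i : I) → Carrier (F i)) → (j : I) → Carrier (F j) → (i : I) → Carrier (F i)
  upd u j a i with i ≟ j
  ... | yes refl = a
  ... | no _     = u i

  B : Set
  B = Σ ((i : I) → Carrier (F i)) λ u →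
      Σ (List I) λ S → ∀ i → i ∉ S → u i ≡ 𝟏 (F i)

  𝟏B : B
  𝟏B = (λ i → 𝟏 (F i)) , [] , (λ i _ → refl)

  private
    upd-supp : (u : (i : I) → Carrier (F i)) (S : List I) →
               (∀ i → i ∉ S → u i ≡ 𝟏 (F i)) →
               (j : I) (a : Carrier (F j)) →
               ∀ i → i ∉ (j ∷ S) → upd u j a i ≡ 𝟏 (F i)
    upd-supp u S s j a i i∉ with i ≟ j
    ... | yes refl = ⊥-elim (i∉ (here refl))
    ... | no _     = s i (λ i∈ → i∉ (there i∈))


  star : (j : I) → Carrier (F j) → B → B
  star j a (u , S , s) = upd u j a , j ∷ S , upd-supp u S s j a

  _≤B_ : B → B → Set
  u ≤B v = ∀ i → Frame._≤_ (F i) (proj₁ u i) (proj₁ v i)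

  record CIdeal : Set₁ where
    field
      mem    : B → Set
      down   : ∀ {u v} → u ≤B v → mem v → mem u
      closed : ∀ (j : I) (u : B) {K : Set} (a : K → Carrier (F j)) →
               (∀ k → mem (star j (a k) u)) → mem (star j (Frame.⋁ (F j) a) u)
  open CIdeal public

  _⊆_ : CIdeal → CIdeal → Set
  J ⊆ J' = ∀ u → mem J u → mem J' u

  n : B → Set
  n u = Σ I λ i → proj₁ u i ≡ 𝟎 (F i)

  strip : (j : I) → Carrier (F j) → B → B → Set
  strip j a u v = (v ≤B star j a u) ⊎ n v

  _≐_ : CIdeal → (B → Set) → Set
  J ≐ P = ∀ v → (mem J v → P v) × (P v → mem J v)

  Strip : I → Set₁
  Strip i = Σ CIdeal λ J → Σ (Carrier (F i)) λ a → J ≐ strip i a 𝟏B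

record OrderIso {a b ℓ₁ ℓ₂ : Level} (A : Set a) (_≤A_ : A → A → Set ℓ₁)
                (B : Set b) (_≤B_ : B → B → Set ℓ₂) : Set (a ⊔ b ⊔ ℓ₁ ⊔ ℓ₂) where
  field
    to        : A → B
    from      : B → A
    to-mono   : ∀ {x y} → x ≤A y → to x ≤B to y
    from-mono : ∀ {x y} → x ≤B y → from x ≤A from y
    from-to   : ∀ x → (from (to x) ≤A x) × (x ≤A from (to x))
    to-from   : ∀ y → (to (from y) ≤B y) × (y ≤B to (from y))

module CoproductD (I : Set) (_≟_ : DecidableEquality I) (D : I → DFrame) where
  module C⁺ = Coproduct I _≟_ (λ i → DFrame.L⁺ (D i))
  module C⁻ = Coproduct I _≟_ (λ i → DFrame.L⁻ (D i))

  con₁ : C⁺.CIdeal → C⁻.CIdeal → Set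
  con₁ J J' = Σ I λ j → Σ (Carrier (DFrame.L⁺ (D j))) λ a → Σ (Carrier (DFrame.L⁻ (D j))) λ b →
              DFrame.con (D j) a b × (C⁺._≐_ J (C⁺.strip j a C⁺.𝟏B)) × (C⁻._≐_ J' (C⁻.strip j b C⁻.𝟏B))

  tot₁ : C⁺.CIdeal → C⁻.CIdeal → Set
  tot₁ J J' = Σ I λ j → Σ (Carrier (DFrame.L⁺ (D j))) λ a → Σ (Carrier (DFrame.L⁻ (D j))) λ b →
              DFrame.tot (D j) a b × (C⁺._≐_ J (C⁺.strip j a C⁺.𝟏B)) × (C⁻._≐_ J' (C⁻.strip j b C⁻.𝟏B))

  S⁺ S⁻ : I → Set₁
  S⁺ = C⁺.Strip
  S⁻ = C⁻.Strip

  _⊑⁺_ : ∀ {i} → S⁺ i → S⁺ i → Set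
  s ⊑⁺ t = C⁺._⊆_ (proj₁ s) (proj₁ t)

  _⊑⁻_ : ∀ {i} → S⁻ i → S⁻ i → Set
  s ⊑⁻ t = C⁻._⊆_ (proj₁ s) (proj₁ t)

  record StripIso (i : I) : Set₁ where
    private
      module Li = DFrame (D i)
    field
      iso⁺ : OrderIso (Carrier Li.L⁺) (Frame._≤_ Li.L⁺) (S⁺ i) _⊑⁺_
      iso⁻ : OrderIso (Carrier Li.L⁻) (Frame._≤_ Li.L⁻) (S⁻ i) _⊑⁻_
    private
      to⁺ = OrderIso.to iso⁺
      to⁻ = OrderIso.to iso⁻
    field
      con-pres : ∀ a b → Li.con a b → con₁ (proj₁ (to⁺ a)) (proj₁ (to⁻ b))
      con-refl : ∀ a b → con₁ (proj₁ (to⁺ a)) (proj₁ (to⁻ b)) → Li.con a b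
      tot-pres : ∀ a b → Li.tot a b → tot₁ (proj₁ (to⁺ a)) (proj₁ (to⁻ b))
      tot-refl : ∀ a b → tot₁ (proj₁ (to⁺ a)) (proj₁ (to⁻ b)) → Li.tot a b

-- The strip a ⊕ᵢ 𝟏 is the set of null elements together with the u with uᵢ ≤ a. It is a
-- C-ideal: classically, a join ⋁ₖ fₖ placed at coordinate j either happens at j = i, or at
-- some j ≠ i where either the i-th coordinate is already below a or all fₖ are 0 (and the
-- element is null). Nontriviality makes c ∗ᵢ 𝟏 null only for c = 0, so membership of c ∗ᵢ 𝟏
-- recovers a and a ↦ a ⊕ᵢ 𝟏 is an order isomorphism onto the i-strips. A pair of i-strips
-- is in con₁ (tot₁) through some index j: for j = i this is conⁱ (totⁱ); for j ≠ i both strips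
-- are also j-strips, hence each is the bottom or the top strip, and on such corner pairs the
-- d-frame axioms decide con and tot in the same way for every index: con fails only at
-- (1, 1) and tot only at (0, 0).

module Submission where

open import Defs
open import Level using (0ℓ)
open import Axiom.ExcludedMiddle using (ExcludedMiddle)
open import Data.Bool using (Bool; true; false)
open import Data.Empty using (⊥-elim)
open import Data.Product using (Σ; _×_; _,_; proj₁; proj₂)
open import Data.Sum using (_⊎_; inj₁; inj₂)
open import Function using (id; _∘_)
open import Relation.Binary.Definitions using (DecidableEquality)
open import Relation.Binary.PropositionalEquality using (_≡_; _≢_; refl; sym; trans; subst; subst₂)
open import Relation.Nullary using (¬_; Dec; yes; no)

module FrameProperties (L : Frame) where
  open Frame L using (_≤_; ≤-refl; ≤-antisym; ⋁; ⋁-least; 𝟏-max)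

  𝟎-min : ∀ {x} → 𝟎 L ≤ x
  𝟎-min = ⋁-least ⊥-elim (λ ())

  ≤𝟎⇒≡𝟎 : ∀ {x} → x ≤ 𝟎 L → x ≡ 𝟎 L
  ≤𝟎⇒≡𝟎 x≤𝟎 = ≤-antisym x≤𝟎 𝟎-min

  𝟏≤⇒≡𝟏 : ∀ {x} → 𝟏 L ≤ x → x ≡ 𝟏 L
  𝟏≤⇒≡𝟏 𝟏≤x = ≤-antisym 𝟏-max 𝟏≤x

  ≡𝟎⇒≤ : ∀ {x y} → x ≡ 𝟎 L → x ≤ y
  ≡𝟎⇒≤ refl = 𝟎-min

  ⋁-≡𝟎 : ∀ {K : Set} (f : K → Carrier L) → (∀ k → f k ≡ 𝟎 L) → ⋁ f ≡ 𝟎 L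
  ⋁-≡𝟎 f f≡𝟎 = ≤𝟎⇒≡𝟎 (⋁-least f (λ k → ≡𝟎⇒≤ (f≡𝟎 k)))

  nontrivial⇒𝟏≰𝟎 : Nontrivial L → ¬ (𝟏 L ≤ 𝟎 L)
  nontrivial⇒𝟏≰𝟎 nt 𝟏≤𝟎 = nt (sym (≤𝟎⇒≡𝟎 𝟏≤𝟎))

  fromBool : Bool → Carrier L
  fromBool false = 𝟎 L
  fromBool true  = 𝟏 L

open FrameProperties

module Strips (I : Set) (_≟_ : DecidableEquality I) (F : I → Frame) where
  open Coproduct I _≟_ F
  private
    module Fᵢ (l : I) = Frame (F l)

  upd-self : ∀ u j (x : Carrier (F j)) → upd u j x j ≡ x
  upd-self u j x with j ≟ j
  ... | yes refl = refl
  ... | no j≢j  = ⊥-elim (j≢j refl)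

  upd-other : ∀ u j (x : Carrier (F j)) {l} → l ≢ j → upd u j x l ≡ u l
  upd-other u j x {l} l≢j with l ≟ j
  ... | yes refl = ⊥-elim (l≢j refl)
  ... | no _     = refl

  ≤B-refl : ∀ {v} → v ≤B v
  ≤B-refl l = Fᵢ.≤-refl l

  ≤B-star𝟏B⁺ : ∀ i {a} v → Fᵢ._≤_ i (proj₁ v i) a → v ≤B star i a 𝟏B
  ≤B-star𝟏B⁺ i v vᵢ≤a l with l ≟ i
  ... | yes refl = vᵢ≤a
  ... | no _     = Fᵢ.𝟏-max l

  ≤B-star𝟏B⁻ : ∀ i {a} v → v ≤B star i a 𝟏B → Fᵢ._≤_ i (proj₁ v i) a
  ≤B-star𝟏B⁻ i {a} v v≤ = subst (Fᵢ._≤_ i _) (upd-self _ i a) (v≤ i)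

  null-down : ∀ u v → u ≤B v → n v → n u
  null-down u v u≤v (l , vₗ≡𝟎) = l , ≤𝟎⇒≡𝟎 (F l) (subst (Fᵢ._≤_ l _) vₗ≡𝟎 (u≤v l))

  NullOff : I → B → Set
  NullOff j u = Σ I λ l → l ≢ j × proj₁ u l ≡ 𝟎 (F l)

  star-null⁺ : ∀ j c u → NullOff j u → n (star j c u)
  star-null⁺ j c u (l , l≢j , uₗ≡𝟎) = l , trans (upd-other (proj₁ u) j c l≢j) uₗ≡𝟎

  star-null⁻ : ∀ j c u → n (star j c u) → c ≡ 𝟎 (F j) ⊎ NullOff j u
  star-null⁻ j c u (l , e) with l ≟ j
  ... | yes refl = inj₁ e
  ... | no l≢j   = inj₂ (l , l≢j , e)

  strip-down : ∀ i a {u v} → u ≤B v → strip i a 𝟏B v → strip i a 𝟏B u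
  strip-down i a u≤v (inj₁ v≤) = inj₁ (λ l → Fᵢ.≤-trans l (u≤v l) (v≤ l))
  strip-down i a {u} {v} u≤v (inj₂ v-null) = inj₂ (null-down u v u≤v v-null)

  strip-mono : ∀ i {a b} → Fᵢ._≤_ i a b → ∀ v → strip i a 𝟏B v → strip i b 𝟏B v
  strip-mono i a≤b v (inj₁ v≤) = inj₁ (≤B-star𝟏B⁺ i v (Fᵢ.≤-trans i (≤B-star𝟏B⁻ i v v≤) a≤b))
  strip-mono i a≤b v (inj₂ v-null) = inj₂ v-null

  SameStrip : ∀ {i j} → Carrier (F i) → Carrier (F j) → Set
  SameStrip {i} {j} a a' =
    ∀ v → (strip i a 𝟏B v → strip j a' 𝟏B v) × (strip j a' 𝟏B v → strip i a 𝟏B v)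

  sameStrip-refl : ∀ {i} {a : Carrier (F i)} → SameStrip a a
  sameStrip-refl v = id , id

  module _ (em : ExcludedMiddle 0ℓ) where

    strip-closed : ∀ i a j u {K : Set} (f : K → Carrier (F j)) →
                   (∀ k → strip i a 𝟏B (star j (f k) u)) →
                   strip i a 𝟏B (star j (Fᵢ.⋁ j f) u)
    strip-closed i a j u f f∈ with em {NullOff j u}
    ... | yes off = inj₂ (star-null⁺ j _ u off)
    ... | no ¬off = closed-by-index (i ≟ j)
      where
      coordinate-or-𝟎 : ∀ k → Fᵢ._≤_ i (upd (proj₁ u) j (f k) i) a ⊎ f k ≡ 𝟎 (F j)
      coordinate-or-𝟎 k with f∈ k
      ... | inj₁ below = inj₁ (≤B-star𝟏B⁻ i (star j (f k) u) below)
      ... | inj₂ null with star-null⁻ j (f k) u null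
      ...   | inj₁ fₖ≡𝟎 = inj₂ fₖ≡𝟎
      ...   | inj₂ off  = ⊥-elim (¬off off)

      closed-by-index : Dec (i ≡ j) → strip i a 𝟏B (star j (Fᵢ.⋁ j f) u)
      closed-by-index (yes refl) = inj₁ (≤B-star𝟏B⁺ i (star j _ u)
        (subst (λ x → Fᵢ._≤_ i x a) (sym (upd-self _ i _)) (Fᵢ.⋁-least i f fₖ≤a)))
        where
        fₖ≤a : ∀ k → Fᵢ._≤_ i (f k) a
        fₖ≤a k with coordinate-or-𝟎 k
        ... | inj₁ fₖ≤ = subst (λ x → Fᵢ._≤_ i x a) (upd-self _ i _) fₖ≤
        ... | inj₂ fₖ≡𝟎 = ≡𝟎⇒≤ (F i) fₖ≡𝟎
      closed-by-index (no i≢j) with em {Fᵢ._≤_ i (proj₁ u i) a}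
      ... | yes uᵢ≤a = inj₁ (≤B-star𝟏B⁺ i (star j _ u)
                         (subst (λ x → Fᵢ._≤_ i x a) (sym (upd-other _ j _ i≢j)) uᵢ≤a))
      ... | no uᵢ≰a  = inj₂ (j , trans (upd-self _ j _) (⋁-≡𝟎 (F j) f fₖ≡𝟎))
        where
        -- the i-th coordinate of star j (f k) u is u i, which is not below a
        fₖ≡𝟎 : ∀ k → f k ≡ 𝟎 (F j)
        fₖ≡𝟎 k with coordinate-or-𝟎 k
        ... | inj₁ uᵢ≤ = ⊥-elim (uᵢ≰a (subst (λ x → Fᵢ._≤_ i x a) (upd-other _ j _ i≢j) uᵢ≤))
        ... | inj₂ fₖ≡𝟎 = fₖ≡𝟎

    stripIdeal : ∀ i → Carrier (F i) → CIdeal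
    stripIdeal i a = record
      { mem = strip i a 𝟏B ; down = λ {u} {v} → strip-down i a {u} {v} ; closed = strip-closed i a }

    toStrip : ∀ i → Carrier (F i) → Strip i
    toStrip i a = stripIdeal i a , a , sameStrip-refl

  star∈strip : ∀ i a → strip i a 𝟏B (star i a 𝟏B)
  star∈strip i a = inj₁ (≤B-refl {star i a 𝟏B})

  module _ (nt : ∀ i → Nontrivial (F i)) where

    star𝟏B-null⁻ : ∀ i c → n (star i c 𝟏B) → c ≡ 𝟎 (F i)
    star𝟏B-null⁻ i c null with star-null⁻ i c 𝟏B null
    ... | inj₁ c≡𝟎 = c≡𝟎
    ... | inj₂ (l , _ , 𝟏≡𝟎) = ⊥-elim (nt l (sym 𝟏≡𝟎))

    star∈strip⁻ : ∀ i a c → strip i a 𝟏B (star i c 𝟏B) → Fᵢ._≤_ i c a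
    star∈strip⁻ i a c (inj₁ below) =
      subst (λ x → Fᵢ._≤_ i x a) (upd-self _ i c) (≤B-star𝟏B⁻ i (star i c 𝟏B) below)
    star∈strip⁻ i a c (inj₂ null) = ≡𝟎⇒≤ (F i) {y = a} (star𝟏B-null⁻ i c null)

    star∈other-strip⁻ : ∀ {i j} a' c → j ≢ i → strip j a' 𝟏B (star i c 𝟏B) →
                        a' ≡ 𝟏 (F j) ⊎ c ≡ 𝟎 (F i)
    star∈other-strip⁻ {i} {j} a' c j≢i (inj₁ below) = inj₁ (𝟏≤⇒≡𝟏 (F j)
      (subst (λ x → Fᵢ._≤_ j x a') (upd-other _ i c j≢i) (≤B-star𝟏B⁻ j (star i c 𝟏B) below)))
    star∈other-strip⁻ {i} a' c j≢i (inj₂ null) = inj₂ (star𝟏B-null⁻ i c null)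

    strip-⊆⇒≤ : ∀ i {a b} → (∀ v → strip i a 𝟏B v → strip i b 𝟏B v) → Fᵢ._≤_ i a b
    strip-⊆⇒≤ i {a} {b} a⊆b = star∈strip⁻ i b a (a⊆b (star i a 𝟏B) (star∈strip i a))

    sameStrip-injective : ∀ {i} {a a' : Carrier (F i)} → SameStrip a a' → a ≡ a'
    sameStrip-injective {i} a≐a' =
      Fᵢ.≤-antisym i (strip-⊆⇒≤ i (proj₁ ∘ a≐a')) (strip-⊆⇒≤ i (proj₂ ∘ a≐a'))

    -- the only strips along two distinct coordinates are 0 ⊕ 𝟏 = n and 1 ⊕ 𝟏 = B
    sameStrip-fromBool : ∀ {i j} {a : Carrier (F i)} {a' : Carrier (F j)} →
                         j ≢ i → SameStrip a a' →
                         Σ Bool λ t → a ≡ fromBool (F i) t × a' ≡ fromBool (F j) t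
    sameStrip-fromBool {i} {j} {a} {a'} j≢i a≐a'
      with star∈other-strip⁻ a' a j≢i (proj₁ (a≐a' (star i a 𝟏B)) (star∈strip i a))
         | star∈other-strip⁻ a a' (j≢i ∘ sym) (proj₂ (a≐a' (star j a' 𝟏B)) (star∈strip j a'))
    ... | inj₁ a'≡𝟏 | inj₁ a≡𝟏  = true , a≡𝟏 , a'≡𝟏
    ... | inj₂ a≡𝟎  | inj₂ a'≡𝟎 = false , a≡𝟎 , a'≡𝟎
    ... | inj₁ a'≡𝟏 | inj₂ a'≡𝟎 = ⊥-elim (nt j (trans (sym a'≡𝟎) a'≡𝟏))
    ... | inj₂ a≡𝟎  | inj₁ a≡𝟏  = ⊥-elim (nt i (trans (sym a≡𝟎) a≡𝟏))

    stripIso : ExcludedMiddle 0ℓ → ∀ i →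
               OrderIso (Carrier (F i)) (Fᵢ._≤_ i) (Strip i) (λ s t → proj₁ s ⊆ proj₁ t)
    stripIso em i = record
      { to        = toStrip em i
      ; from      = proj₁ ∘ proj₂
      ; to-mono   = strip-mono i
      ; from-mono = λ { {_ , a , J≐a} {_ , b , J'≐b} J⊆J' →
                        strip-⊆⇒≤ i (λ v → proj₁ (J'≐b v) ∘ J⊆J' v ∘ proj₂ (J≐a v)) }
      ; from-to   = λ a → Fᵢ.≤-refl i , Fᵢ.≤-refl i
      ; to-from   = λ { (_ , a , J≐a) → proj₂ ∘ J≐a , proj₁ ∘ J≐a }
      }

module DFrameProperties (D : DFrame) where
  open DFrame D
  private
    module P = Frame L⁺
    module M = Frame L⁻

  con-𝟎ˡ : ∀ {b} → con (𝟎 L⁺) b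
  con-𝟎ˡ = con-↓ con-ff P.≤-refl M.𝟏-max

  con-𝟎ʳ : ∀ {a} → con a (𝟎 L⁻)
  con-𝟎ʳ = con-↓ con-tt P.𝟏-max M.≤-refl

  tot-𝟏ˡ : ∀ {b} → tot (𝟏 L⁺) b
  tot-𝟏ˡ = tot-↑ tot-tt P.≤-refl (𝟎-min L⁻)

  tot-𝟏ʳ : ∀ {a} → tot a (𝟏 L⁻)
  tot-𝟏ʳ = tot-↑ tot-ff (𝟎-min L⁺) M.≤-refl

  ¬con-𝟏𝟏 : Nontrivial L⁻ → ¬ con (𝟏 L⁺) (𝟏 L⁻)
  ¬con-𝟏𝟏 nt c = nontrivial⇒𝟏≰𝟎 L⁻ nt (proj₂ (con-tot c tot-tt (inj₁ refl)))

  ¬tot-𝟎𝟎 : Nontrivial L⁺ → ¬ tot (𝟎 L⁺) (𝟎 L⁻)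
  ¬tot-𝟎𝟎 nt t = nontrivial⇒𝟏≰𝟎 L⁺ nt (proj₁ (con-tot con-tt t (inj₂ refl)))

open DFrameProperties

module _ (D D' : DFrame) where
  open DFrame

  con-fromBool-transport : Nontrivial (L⁻ D) → ∀ t s →
    con D  (fromBool (L⁺ D) t)  (fromBool (L⁻ D) s) →
    con D' (fromBool (L⁺ D') t) (fromBool (L⁻ D') s)
  con-fromBool-transport nt false s     _ = con-𝟎ˡ D'
  con-fromBool-transport nt true  false _ = con-𝟎ʳ D'
  con-fromBool-transport nt true  true  c = ⊥-elim (¬con-𝟏𝟏 D nt c)

  tot-fromBool-transport : Nontrivial (L⁺ D) → ∀ t s →
    tot D  (fromBool (L⁺ D) t)  (fromBool (L⁻ D) s) →
    tot D' (fromBool (L⁺ D') t) (fromBool (L⁻ D') s)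
  tot-fromBool-transport nt true  s     _ = tot-𝟏ˡ D'
  tot-fromBool-transport nt false true  _ = tot-𝟏ʳ D'
  tot-fromBool-transport nt false false t = ⊥-elim (¬tot-𝟎𝟎 D nt t)

module StripRelations (I : Set) (_≟_ : DecidableEquality I) (D : I → DFrame)
                      (nt⁺ : ∀ i → Nontrivial (DFrame.L⁺ (D i)))
                      (nt⁻ : ∀ i → Nontrivial (DFrame.L⁻ (D i))) where
  open DFrame
  module S⁺ = Strips I _≟_ (L⁺ ∘ D)
  module S⁻ = Strips I _≟_ (L⁻ ∘ D)

  -- con₁ and tot₁ between i-strips are StripRelated con i and StripRelated tot i
  StripRelated : (R : ∀ j → Carrier (L⁺ (D j)) → Carrier (L⁻ (D j)) → Set) →
                 ∀ i → Carrier (L⁺ (D i)) → Carrier (L⁻ (D i)) → Set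
  StripRelated R i a b = Σ I λ j → Σ (Carrier (L⁺ (D j))) λ a' → Σ (Carrier (L⁻ (D j))) λ b' →
                         R j a' b' × S⁺.SameStrip a a' × S⁻.SameStrip b b'

  stripRelated⁻ : (R : ∀ j → Carrier (L⁺ (D j)) → Carrier (L⁻ (D j)) → Set) →
                  (∀ {j k} t s → R j (fromBool _ t) (fromBool _ s) →
                                 R k (fromBool _ t) (fromBool _ s)) →
                  ∀ i a b → StripRelated R i a b → R i a b
  stripRelated⁻ R transport i a b (j , a' , b' , r , a≐a' , b≐b') with j ≟ i
  ... | yes refl = subst₂ (R i) (sym (S⁺.sameStrip-injective nt⁺ a≐a'))
                                (sym (S⁻.sameStrip-injective nt⁻ b≐b')) r
  ... | no j≢i with S⁺.sameStrip-fromBool nt⁺ j≢i a≐a' | S⁻.sameStrip-fromBool nt⁻ j≢i b≐b'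
  ...   | t , refl , refl | s , refl , refl = transport t s r

lemma20 : ExcludedMiddle 0ℓ →
    (I : Set) (_≟_ : DecidableEquality I) (D : I → DFrame) →
    (∀ i → Nontrivial (DFrame.L⁺ (D i))) → (∀ i → Nontrivial (DFrame.L⁻ (D i))) →
    (i : I) → CoproductD.StripIso I _≟_ D i
lemma20 em I _≟_ D nt⁺ nt⁻ i = record
  { iso⁺     = S⁺.stripIso nt⁺ em i
  ; iso⁻     = S⁻.stripIso nt⁻ em i
  ; con-pres = λ a b c → i , a , b , c , S⁺.sameStrip-refl , S⁻.sameStrip-refl
  ; con-refl = stripRelated⁻ (DFrame.con ∘ D)
                 (λ {j} {k} → con-fromBool-transport (D j) (D k) (nt⁻ j)) i
  ; tot-pres = λ a b t → i , a , b , t , S⁺.sameStrip-refl , S⁻.sameStrip-refl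
  ; tot-refl = stripRelated⁻ (DFrame.tot ∘ D)
                 (λ {j} {k} → tot-fromBool-transport (D j) (D k) (nt⁺ j)) i
  }
  where open StripRelations I _≟_ D nt⁺ nt⁻
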